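{- Let $G$ be a connected, locally finite chordal graph and $F\in\mathfrak{F}(G)$ a clique family. Then the multigraph $\Gamma^{=}(F)/\sim_F$ is complete, i.e. any two distinct vertices of it are joined by at least one edge.
   Context: A chordal graph is a loopless graph without multiple edges with no induced cycle of length greater than $3$; chordal graphs are assumed connected; locally finite means all degrees finite. A clique is a maximal complete vertex set; $\mathcal{K}(G)$ is the set of cliques. For a complete set $C$ (possibly empty), $F(C):=\{K\in\mathcal{K}(G):C\subseteq K\}$; $\mathfrak{F}(G)$ is the set of all such clique families. For $F\in\mathfrak{F}(G)$: $\Gamma^{=}(F)$ is the graph on $F$ with an edge $K_1K_2$ (distinct, intersecting $K_1,K_2\in F$) whenever $F(K_1\cap K_2)=F$; $\Gamma^{<}(F)$ is the graph on $F$ with an edge $K_1K_2$ (distinct, intersecting) whenever $F(K_1\cap K_2)\subsetneq F$; $\sim_F$ is the equivalence relation whose classes are the connected components of $\Gamma^{<}(F)$; $\Gamma^{=}(F)/\sim_F$ is the multigraph obtained from $\Gamma^{=}(F)$ by contracting each $\sim_F$-class to a single vertex. -}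

module Defs where

open import Level using (0ℓ) renaming (suc to lsuc)
open import Data.Nat using (ℕ; suc; _+_; _%_)
open import Data.Fin using (Fin; toℕ)
open import Data.List using (List)
open import Data.List.Membership.Propositional using (_∈_)
open import Data.Product using (Σ; ∃; _×_; _,_)
open import Data.Sum using (_⊎_)
open import Function.Bundles using (_⇔_)
open import Function.Definitions using (Injective)
open import Relation.Nullary using (¬_)
open import Relation.Unary using (Pred; _⊆_; _≐_; _∩_)
open import Relation.Binary.PropositionalEquality using (_≡_; _≢_)
open import Relation.Binary.Construct.Closure.ReflexiveTransitive using (Star)

record Graph : Set₁ where
  field
    V      : Set
    E      : V → V → Set
    sym    : ∀ {u v} → E u v → E v u
    irrefl : ∀ {v} → ¬ E v v

module _ (G : Graph) where
  open Graph G

  Connected : Set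
  Connected = ∀ u v → Star E u v

  LocallyFinite : Set
  LocallyFinite = ∀ v → ∃ λ (xs : List V) → ∀ u → E v u → u ∈ xs

  CycAdj : (k : ℕ) → Fin (4 + k) → Fin (4 + k) → Set
  CycAdj k i j = (suc (toℕ i) % (4 + k) ≡ toℕ j) ⊎ (suc (toℕ j) % (4 + k) ≡ toℕ i)

  -- an induced cycle of length 4 + k (so of length > 3)
  InducedCycle : (k : ℕ) → (Fin (4 + k) → V) → Set
  InducedCycle k f = Injective _≡_ _≡_ f × (∀ i j → E (f i) (f j) ⇔ CycAdj k i j)

  Chordal : Set
  Chordal = ∀ k (f : Fin (4 + k) → V) → ¬ InducedCycle k f

  VSet : Set₁
  VSet = Pred V 0ℓ

  IsComplete : VSet → Set
  IsComplete C = ∀ u v → C u → C v → u ≢ v → E u v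

  -- clique = maximal complete vertex set
  IsClique : VSet → Set₁
  IsClique K = IsComplete K × (∀ (C : VSet) → IsComplete C → K ⊆ C → C ⊆ K)

  -- membership in the clique family F(C) = {K clique : C ⊆ K}
  InF : VSet → VSet → Set₁
  InF C K = IsClique K × C ⊆ K

  FamSub : VSet → VSet → Set₁
  FamSub D C = ∀ K → InF D K → InF C K

  FamEq : VSet → VSet → Set₁
  FamEq D C = FamSub D C × FamSub C D

  Intersect : VSet → VSet → Set
  Intersect K₁ K₂ = ∃ λ v → K₁ v × K₂ v

  -- edge of Γ^=(F(C)) (K₁,K₂ assumed in F(C))
  EqEdge : VSet → VSet → VSet → Set₁
  EqEdge C K₁ K₂ = ¬ (K₁ ≐ K₂) × Intersect K₁ K₂ × FamEq (K₁ ∩ K₂) C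

  LtEdge : VSet → VSet → VSet → Set₁
  LtEdge C K₁ K₂ = ¬ (K₁ ≐ K₂) × Intersect K₁ K₂
                 × (FamSub (K₁ ∩ K₂) C × ¬ FamEq (K₁ ∩ K₂) C)

  SimStep : VSet → VSet → VSet → Set₁
  SimStep C K₁ K₂ = InF C K₁ × InF C K₂ × ((K₁ ≐ K₂) ⊎ LtEdge C K₁ K₂)

  -- ∼_F : connected components of Γ^<(F(C))
  Sim : VSet → VSet → VSet → Set₁
  Sim C = Star (SimStep C)

-- If K₁ and K₂ meet, then F(K₁ ∩ K₂) ⊆ F, and equality is an edge of Γ^=(F) while a strict
-- inclusion is an edge of Γ^<(F). If they are disjoint, then C ⊆ K₁ ∩ K₂ is empty, so F
-- consists of all cliques and no two cliques span an edge of Γ^=(F): every pair of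
-- intersecting cliques is joined in Γ^<(F). Covering a walk between K₁ and K₂ by cliques
-- through its edges (which exist by local finiteness) then puts K₁ ∼_F K₂.
module Submission where

open import Defs
open import Level using (0ℓ; lift; lower) renaming (suc to lsuc)
open import Axiom.ExcludedMiddle using (ExcludedMiddle)
open import Data.Product using (Σ; ∃; _×_; _,_; proj₁; proj₂)
open import Data.Sum using (_⊎_; inj₁; inj₂)
open import Data.Empty using (⊥-elim)
open import Data.List using (List; []; _∷_)
open import Data.List.Membership.Propositional using (_∈_)
open import Data.List.Relation.Unary.Any using (here; there)
open import Relation.Nullary using (¬_; Dec; yes; no)
open import Relation.Nullary.Decidable using (map′)
open import Relation.Binary.PropositionalEquality using (_≡_; refl; sym; trans)
open import Relation.Binary.Construct.Closure.ReflexiveTransitive using (Star; ε; _◅_; _◅◅_)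
open import Relation.Unary using (_≐_; _∩_; _⊆_)

module _ (em : ExcludedMiddle (lsuc 0ℓ)) (G : Graph) where
  open Graph G renaming (sym to E-sym)

  dec : (P : Set) → Dec P
  dec P = map′ lower lift em

  Joinable : List V → V → Set
  Joinable acc x = ∀ y → y ∈ acc → y ≡ x ⊎ E x y

  greedy : List V → List V → List V
  greedy acc []       = acc
  greedy acc (x ∷ xs) with dec (Joinable acc x)
  ... | yes _ = greedy (x ∷ acc) xs
  ... | no  _ = greedy acc xs

  greedy-⊇ : ∀ acc xs → (_∈ acc) ⊆ (_∈ greedy acc xs)
  greedy-⊇ acc []       y∈acc = y∈acc
  greedy-⊇ acc (x ∷ xs) y∈acc with dec (Joinable acc x)
  ... | yes _ = greedy-⊇ (x ∷ acc) xs (there y∈acc)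
  ... | no  _ = greedy-⊇ acc xs y∈acc

  complete-∷ : ∀ {acc x} → IsComplete G (_∈ acc) → Joinable acc x → IsComplete G (_∈ x ∷ acc)
  complete-∷ c j u v (here refl) (here refl) u≢v = ⊥-elim (u≢v refl)
  complete-∷ c j u v (here refl) (there v∈) u≢v with j v v∈
  ... | inj₁ v≡u = ⊥-elim (u≢v (sym v≡u))
  ... | inj₂ e   = e
  complete-∷ c j u v (there u∈) (here refl) u≢v with j u u∈
  ... | inj₁ u≡v = ⊥-elim (u≢v u≡v)
  ... | inj₂ e   = E-sym e
  complete-∷ c j u v (there u∈) (there v∈) u≢v = c u v u∈ v∈ u≢v

  greedy-complete : ∀ acc xs → IsComplete G (_∈ acc) → IsComplete G (_∈ greedy acc xs)
  greedy-complete acc []       c = c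
  greedy-complete acc (x ∷ xs) c with dec (Joinable acc x)
  ... | yes j = greedy-complete (x ∷ acc) xs (complete-∷ c j)
  ... | no  _ = greedy-complete acc xs c

  greedy-maximal : ∀ acc xs {x} → x ∈ xs → Joinable (greedy acc xs) x → x ∈ greedy acc xs
  greedy-maximal acc (x' ∷ xs) x∈ j with dec (Joinable acc x')
  greedy-maximal acc (x' ∷ xs) (here refl) j | yes _  = greedy-⊇ (x' ∷ acc) xs (here refl)
  greedy-maximal acc (x' ∷ xs) (there x∈)  j | yes _  = greedy-maximal (x' ∷ acc) xs x∈ j
  greedy-maximal acc (x' ∷ xs) (here refl) j | no ¬j = ⊥-elim (¬j λ y y∈ → j y (greedy-⊇ acc xs y∈))
  greedy-maximal acc (x' ∷ xs) (there x∈)  j | no _  = greedy-maximal acc xs x∈ j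

  joinable-into : ∀ {D acc x} → IsComplete G D → (_∈ acc) ⊆ D → D x → Joinable acc x
  joinable-into {x = x} cD acc⊆D Dx y y∈ with dec (y ≡ x)
  ... | yes y≡x = inj₁ y≡x
  ... | no  y≢x = inj₂ (cD x y Dx (acc⊆D y∈) λ x≡y → y≢x (sym x≡y))

  complete-list⇒clique : ∀ acc xs → IsComplete G (_∈ acc)
    → (∀ x → Joinable acc x → x ∈ acc ⊎ x ∈ xs)
    → Σ (VSet G) λ K → IsClique G K × (_∈ acc) ⊆ K
  complete-list⇒clique acc xs c candidates =
    (_∈ greedy acc xs) , (greedy-complete acc xs c , maximal) , greedy-⊇ acc xs
    where
    maximal : ∀ D → IsComplete G D → (_∈ greedy acc xs) ⊆ D → D ⊆ (_∈ greedy acc xs)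
    maximal D cD K⊆D {x} Dx
      with candidates x (joinable-into cD (λ y∈ → K⊆D (greedy-⊇ acc xs y∈)) Dx)
    ... | inj₁ x∈acc = greedy-⊇ acc xs x∈acc
    ... | inj₂ x∈xs  = greedy-maximal acc xs x∈xs (joinable-into cD K⊆D Dx)

  edge⇒clique : LocallyFinite G → ∀ {a b} → E a b → Σ (VSet G) λ K → IsClique G K × K a × K b
  edge⇒clique lf {a} {b} e =
    let K , cK , ab⊆K = complete-list⇒clique (a ∷ b ∷ []) (proj₁ (lf a)) complete candidates
    in  K , cK , ab⊆K (here refl) , ab⊆K (there (here refl))
    where
    complete : IsComplete G (_∈ a ∷ b ∷ [])
    complete = complete-∷ (complete-∷ (λ _ _ ()) λ _ ()) λ { _ (here refl) → inj₂ e ; _ (there ()) }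
    candidates : ∀ x → Joinable (a ∷ b ∷ []) x → x ∈ a ∷ b ∷ [] ⊎ x ∈ proj₁ (lf a)
    candidates x j with j a (here refl)
    ... | inj₁ refl = inj₁ (here refl)
    ... | inj₂ x~a  = inj₂ (proj₂ (lf a) x (E-sym x~a))

  clique-inhabited : V → ∀ {K} → IsClique G K → ∃ K
  clique-inhabited u {K} (_ , maximal) with dec (∃ K)
  ... | yes inhabited = inhabited
  ... | no  empty     = u , maximal (_≡ u) (λ x y x≡u y≡u x≢y → ⊥-elim (x≢y (trans x≡u (sym y≡u))))
                                   (λ {x} Kx → ⊥-elim (empty (x , Kx))) refl

  cliques-linked : Connected G → LocallyFinite G → (R : VSet G → VSet G → Set₁)
    → (∀ {L L'} → IsClique G L → IsClique G L' → Intersect G L L' → Star R L L')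
    → ∀ {K K' v w} → IsClique G K → IsClique G K' → K v → K' w → Star R K K'
  cliques-linked conn lf R link {K' = K'} {v} {w} cK cK' Kv K'w = walk (conn v w) cK Kv
    where
    walk : ∀ {x L} → Star E x w → IsClique G L → L x → Star R L K'
    walk {x} ε cL Lx = link cL cK' (x , Lx , K'w)
    walk {x} (e ◅ p) cL Lx with edge⇒clique lf e
    ... | M , cM , Mx , My = link cL cM (x , Lx , Mx) ◅◅ walk p cM My

  famSub-∩ : ∀ {C L L'} → InF G C L → InF G C L' → FamSub G (L ∩ L') C
  famSub-∩ FL FL' K (cK , L∩L'⊆K) = cK , λ Cx → L∩L'⊆K (proj₂ FL Cx , proj₂ FL' Cx)

  sim⊎eqEdge : ∀ {C L L'} → InF G C L → InF G C L' → Intersect G L L'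
    → Sim G C L L' ⊎ EqEdge G C L L'
  sim⊎eqEdge {C} {L} {L'} FL FL' meet with dec (L ≐ L')
  ... | yes L≐L' = inj₁ ((FL , FL' , inj₁ L≐L') ◅ ε)
  ... | no  L≭L' with em {FamEq G (L ∩ L') C}
  ...   | yes F≡ = inj₂ (L≭L' , meet , F≡)
  ...   | no  F≢ = inj₁ ((FL , FL' , inj₂ (L≭L' , meet , famSub-∩ FL FL' , F≢)) ◅ ε)

  module _ {C K₁ K₂} (FK₁ : InF G C K₁) (FK₂ : InF G C K₂) (disjoint : ¬ Intersect G K₁ K₂) where

    disjoint⇒clique∈F : ∀ {L} → IsClique G L → InF G C L
    disjoint⇒clique∈F cL = cL , λ {x} Cx → ⊥-elim (disjoint (x , proj₂ FK₁ Cx , proj₂ FK₂ Cx))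

    disjoint⇒¬eqEdge : ∀ {L L'} → ¬ EqEdge G C L L'
    disjoint⇒¬eqEdge (_ , (x , Lx , L'x) , _ , F⊆F[L∩L']) =
      disjoint (x , proj₂ (F⊆F[L∩L'] K₁ FK₁) (Lx , L'x) , proj₂ (F⊆F[L∩L'] K₂ FK₂) (Lx , L'x))

    disjoint⇒sim : Connected G → LocallyFinite G → Sim G C K₁ K₂
    disjoint⇒sim conn lf with dec V
    ... | no ¬V = (FK₁ , FK₂ , inj₁ ((λ {x} _ → ⊥-elim (¬V x)) , (λ {x} _ → ⊥-elim (¬V x)))) ◅ ε
    ... | yes u with clique-inhabited u (proj₁ FK₁) | clique-inhabited u (proj₁ FK₂)
    ...   | v , K₁v | w , K₂w = cliques-linked conn lf (SimStep G C) link (proj₁ FK₁) (proj₁ FK₂) K₁v K₂w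
      where
      link : ∀ {L L'} → IsClique G L → IsClique G L' → Intersect G L L' → Sim G C L L'
      link cL cL' meet with sim⊎eqEdge (disjoint⇒clique∈F cL) (disjoint⇒clique∈F cL') meet
      ... | inj₁ L∼L' = L∼L'
      ... | inj₂ edge = ⊥-elim (disjoint⇒¬eqEdge edge)

proposition3p6 : ExcludedMiddle (lsuc 0ℓ) → (G : Graph)
    → Connected G → LocallyFinite G → Chordal G
    → (C : VSet G) → IsComplete G C
    → (K₁ K₂ : VSet G) → InF G C K₁ → InF G C K₂
    → ¬ Sim G C K₁ K₂
    → Σ (VSet G) λ K₁' → Σ (VSet G) λ K₂'
    → InF G C K₁' × InF G C K₂' × Sim G C K₁ K₁' × Sim G C K₂ K₂'
    × EqEdge G C K₁' K₂'
proposition3p6 em G conn lf _ C _ K₁ K₂ FK₁ FK₂ K₁≁K₂ with dec em G (Intersect G K₁ K₂)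
... | no  disjoint = ⊥-elim (K₁≁K₂ (disjoint⇒sim em G FK₁ FK₂ disjoint conn lf))
... | yes meet with sim⊎eqEdge em G FK₁ FK₂ meet
...   | inj₁ K₁∼K₂ = ⊥-elim (K₁≁K₂ K₁∼K₂)
...   | inj₂ edge  = K₁ , K₂ , FK₁ , FK₂ , ε , ε , edge
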